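{- Let $X$ be a finite set and let $F$ and $G$ be Plott choice functions on $X$. Then the choice function $F*G$ on $X$, defined by $(F*G)(A)=F(A)\cup G(A\setminus F(A))$ for $A\subseteq X$, is a Plott choice function.
   Context: A choice function (CF) on a set $X$ is a map $C:2^X\to 2^X$ with $C(A)\subseteq A$ for all $A\subseteq X$. $C$ is consistent if $C(A)\subseteq B\subseteq A$ implies $C(B)=C(A)$; $C$ is substitutable if $B\subseteq A$ implies $C(A)\cap B\subseteq C(B)$. A Plott CF is a CF that is both consistent and substitutable. -}

module Defs where

open import Data.Nat using (ℕ)
open import Data.Product using (_×_)
open import Relation.Binary.PropositionalEquality using (_≡_)
open import Data.Fin.Subset using (Subset; _⊆_; _∩_; _∪_; _─_)

-- A finite set X is modelled as Fin n; subsets of X are Subset n.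
-- A choice function on X is a map C : 2^X → 2^X with C(A) ⊆ A.
record ChoiceFunction (n : ℕ) : Set where
  field
    C       : Subset n → Subset n
    C-subset : ∀ A → C A ⊆ A
open ChoiceFunction public

Consistent : ∀ {n} → ChoiceFunction n → Set
Consistent {n} F = ∀ (A B : Subset n) → C F A ⊆ B → B ⊆ A → C F B ≡ C F A

Substitutable : ∀ {n} → ChoiceFunction n → Set
Substitutable {n} F = ∀ (A B : Subset n) → B ⊆ A → C F A ∩ B ⊆ C F B

Plott : ∀ {n} → ChoiceFunction n → Set
Plott F = Consistent F × Substitutable F

starMap : ∀ {n} → ChoiceFunction n → ChoiceFunction n → Subset n → Subset n
starMap F G A = C F A ∪ C G (A ─ C F A)

-- Substitutability of F makes
-- the rejected set A ∖ F(A) monotone in A, which transfers substitutability of G to the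
-- second stage; for consistency, shrinking A to B ⊇ (F ⋆ G)(A) leaves F(A) unchanged, and
-- then B ∖ F(A) is a shrinking of A ∖ F(A) that still contains G's choice.
module Submission where

open import Defs
open import Data.Nat using (ℕ)
open import Data.Fin using (Fin; zero)
open import Data.Fin.Subset
open import Data.Fin.Subset.Properties
  using (_∈?_; drop-there; x∈p∪q⁻; x∈p∪q⁺; x∈p∩q⁻; x∈p∩q⁺)
open import Data.Product using (Σ; _×_; _,_)
open import Data.Sum using (inj₁; inj₂)
open import Data.Vec using (_∷_; here; there)
open import Function using (_∘_)
open import Relation.Nullary using (yes; no)
open import Relation.Binary.PropositionalEquality using (_≡_; refl; cong; module ≡-Reasoning)

private
  variable
    n : ℕ
    x : Fin n

x∈p─q⁻ : ∀ (p q : Subset n) → x ∈ p ─ q → x ∈ p × x ∉ q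
x∈p─q⁻ (inside ∷ p) (outside ∷ q) here = here , λ ()
x∈p─q⁻ {x = zero} (_ ∷ p) (inside ∷ q) ()
x∈p─q⁻ {x = zero} (outside ∷ p) (outside ∷ q) ()
x∈p─q⁻ (_ ∷ p) (_ ∷ q) (there x∈p─q) with x∈p─q⁻ p q x∈p─q
... | x∈p , x∉q = there x∈p , x∉q ∘ drop-there

x∈p─q⁺ : ∀ (p q : Subset n) → x ∈ p → x ∉ q → x ∈ p ─ q
x∈p─q⁺ (inside ∷ p) (outside ∷ q) here x∉q = here
x∈p─q⁺ (inside ∷ p) (inside ∷ q) here x∉q with () ← x∉q here
x∈p─q⁺ (_ ∷ p) (_ ∷ q) (there x∈p) x∉q = there (x∈p─q⁺ p q x∈p (x∉q ∘ there))

─-monoˡ-⊆ : ∀ {p q : Subset n} (r : Subset n) → p ⊆ q → p ─ r ⊆ q ─ r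
─-monoˡ-⊆ {p = p} {q} r p⊆q x∈p─r with x∈p─q⁻ p r x∈p─r
... | x∈p , x∉r = x∈p─q⁺ q r (p⊆q x∈p) x∉r

rejected-mono : (F : ChoiceFunction n) → Substitutable F →
  ∀ {A B} → B ⊆ A → B ─ C F B ⊆ A ─ C F A
rejected-mono F subF {A} {B} B⊆A x∈B─FB with x∈p─q⁻ B (C F B) x∈B─FB
... | x∈B , x∉FB =
  x∈p─q⁺ A (C F A) (B⊆A x∈B) (λ x∈FA → x∉FB (subF A B B⊆A (x∈p∩q⁺ (x∈FA , x∈B))))

_⋆_ : ChoiceFunction n → ChoiceFunction n → ChoiceFunction n
C (F ⋆ G) = starMap F G
C-subset (F ⋆ G) A x∈F⋆G with x∈p∪q⁻ (C F A) _ x∈F⋆G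
... | inj₁ x∈FA = C-subset F A x∈FA
... | inj₂ x∈G = let x∈A , _ = x∈p─q⁻ A (C F A) (C-subset G _ x∈G) in x∈A

⋆-substitutable : (F G : ChoiceFunction n) →
  Substitutable F → Substitutable G → Substitutable (F ⋆ G)
⋆-substitutable F G subF subG A B B⊆A {x} x∈F⋆G∩B with x∈p∩q⁻ (starMap F G A) B x∈F⋆G∩B
... | x∈F⋆GA , x∈B with x∈p∪q⁻ (C F A) _ x∈F⋆GA
...   | inj₁ x∈FA = x∈p∪q⁺ (inj₁ (subF A B B⊆A (x∈p∩q⁺ (x∈FA , x∈B))))
...   | inj₂ x∈GA with x ∈? C F B
...     | yes x∈FB = x∈p∪q⁺ (inj₁ x∈FB)
...     | no x∉FB = x∈p∪q⁺ (inj₂ (subG _ _ (rejected-mono F subF B⊆A)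
                      (x∈p∩q⁺ (x∈GA , x∈p─q⁺ B (C F B) x∈B x∉FB))))

⋆-consistent : (F G : ChoiceFunction n) →
  Consistent F → Consistent G → Consistent (F ⋆ G)
⋆-consistent F G conF conG A B F⋆GA⊆B B⊆A = begin
  C F B ∪ C G (B ─ C F B)  ≡⟨ cong (λ S → S ∪ C G (B ─ S)) FB≡FA ⟩
  C F A ∪ C G (B ─ C F A)  ≡⟨ cong (C F A ∪_) G-stable ⟩
  C F A ∪ C G (A ─ C F A)  ∎
  where
  open ≡-Reasoning
  FB≡FA : C F B ≡ C F A
  FB≡FA = conF A B (F⋆GA⊆B ∘ x∈p∪q⁺ ∘ inj₁) B⊆A
  G-choice⊆B─FA : C G (A ─ C F A) ⊆ B ─ C F A
  G-choice⊆B─FA x∈G =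
    let _ , x∉FA = x∈p─q⁻ A (C F A) (C-subset G _ x∈G)
    in x∈p─q⁺ B (C F A) (F⋆GA⊆B (x∈p∪q⁺ (inj₂ x∈G))) x∉FA
  G-stable : C G (B ─ C F A) ≡ C G (A ─ C F A)
  G-stable = conG _ _ G-choice⊆B─FA (─-monoˡ-⊆ (C F A) B⊆A)

proposition1 : (n : ℕ) (F G : ChoiceFunction n) → Plott F → Plott G →
    Σ (ChoiceFunction n) (λ H → ((A : _) → C H A ≡ starMap F G A) × Plott H)
proposition1 n F G (conF , subF) (conG , subG) =
  F ⋆ G , (λ _ → refl) , ⋆-consistent F G conF conG , ⋆-substitutable F G subF subG
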